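{- Let $t$ be a positive integer and let $T$ be a finite binary tree (every node has 0, 1 or 2 children) in which every node $v$ has a weight $w(v)>0$ such that: if $v$ is a leaf then $w(v)\le1$; if $v$ has two children $v_1,v_2$ then $w(v)\le w(v_1)+w(v_2)$; if $v$ has exactly one child $v_1$ then $w(v)\le w(v_1)+t$. Then $|T|\ge \frac{w(r)}{t}$, where $r$ is the root of $T$ and $|T|$ is the number of nodes of $T$.
   Formalization: The node weights w(v) are rational numbers. -}

module Defs where

open import Data.Nat using (ℕ; suc; _+_)
open import Data.Rational using (ℚ; 0ℚ; 1ℚ; _≤_; _<_)
open import Data.Product using (_×_)
open import Data.Unit using (⊤)

data WTree : Set where
  leaf  : (w : ℚ) → WTree
  node1 : (w : ℚ) → WTree → WTree
  node2 : (w : ℚ) → WTree → WTree → WTree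

weight : WTree → ℚ
weight (leaf w)      = w
weight (node1 w _)   = w
weight (node2 w _ _) = w

size : WTree → ℕ
size (leaf _)        = 1
size (node1 _ c)     = suc (size c)
size (node2 _ c₁ c₂) = suc (size c₁ + size c₂)

Valid : ℚ → WTree → Set
Valid t (leaf w)        = (0ℚ < w) × (w ≤ 1ℚ)
Valid t (node1 w c)     = (0ℚ < w) × (w ≤ weight c Data.Rational.+ t) × Valid t c
Valid t (node2 w c₁ c₂) = (0ℚ < w) × (w ≤ weight c₁ Data.Rational.+ weight c₂)
                          × Valid t c₁ × Valid t c₂

-- By induction on the tree, w(v) ≤ t·|T_v| for every subtree T_v: a leaf has
-- w ≤ 1 ≤ t, a unary node adds t to the bound of its child, and a binary node
-- gets the sum of the bounds of its children, with the t for v itself to spare.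
-- Dividing by t at the root gives the claim.
module Submission where

open import Defs
open import Data.Nat using (ℕ; NonZero)
open import Data.Integer using (+_)
open import Data.Rational using (ℚ; _≤_; _/_; _*_)

open import Data.Nat as ℕ using (suc)
import Data.Integer as ℤ
import Data.Integer.Properties as ℤ
open import Data.Rational using (0ℚ; 1ℚ; _+_; toℚᵘ)
open import Data.Rational.Properties
import Data.Rational.Unnormalised as ℚᵘ
import Data.Rational.Unnormalised.Properties as ℚᵘ
open import Data.Product using (_,_)
open import Relation.Binary.PropositionalEquality using (_≡_; cong; cong₂; sym; trans; module ≡-Reasoning)

-- A natural number n enters ℚ as + n / 1, which does not compute under
-- normalisation; its arithmetic is therefore read off in ℚᵘ, where it does.

[m+n]/1≡m/1+n/1 : ∀ m n → + (m ℕ.+ n) / 1 ≡ + m / 1 + + n / 1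
[m+n]/1≡m/1+n/1 m n = toℚᵘ-injective (begin-equality
  toℚᵘ (+ (m ℕ.+ n) / 1)              ≃⟨ toℚᵘ-fromℚᵘ (+ (m ℕ.+ n) ℚᵘ./ 1) ⟩
  + (m ℕ.+ n) ℚᵘ./ 1                  ≃⟨ ℚᵘ.*≡* (cong (ℤ._* + 1) sum-numerator) ⟨
  + m ℚᵘ./ 1 ℚᵘ.+ + n ℚᵘ./ 1          ≃⟨ ℚᵘ.+-cong (toℚᵘ-fromℚᵘ (+ m ℚᵘ./ 1))
                                                   (toℚᵘ-fromℚᵘ (+ n ℚᵘ./ 1)) ⟨
  toℚᵘ (+ m / 1) ℚᵘ.+ toℚᵘ (+ n / 1)  ≃⟨ toℚᵘ-homo-+ (+ m / 1) (+ n / 1) ⟨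
  toℚᵘ (+ m / 1 + + n / 1)            ∎)
  where
  open ℚᵘ.≤-Reasoning
  sum-numerator : + m ℤ.* + 1 ℤ.+ + n ℤ.* + 1 ≡ + (m ℕ.+ n)
  sum-numerator = trans (cong₂ ℤ._+_ (ℤ.*-identityʳ (+ m)) (ℤ.*-identityʳ (+ n)))
                        (sym (ℤ.pos-+ m n))

n/1*1/n≡1 : ∀ n .{{_ : NonZero n}} → + n / 1 * (+ 1 / n) ≡ 1ℚ
n/1*1/n≡1 n@(suc _) = toℚᵘ-injective (begin-equality
  toℚᵘ (+ n / 1 * (+ 1 / n))          ≃⟨ toℚᵘ-homo-* (+ n / 1) (+ 1 / n) ⟩
  toℚᵘ (+ n / 1) ℚᵘ.* toℚᵘ (+ 1 / n)  ≃⟨ ℚᵘ.*-cong (toℚᵘ-fromℚᵘ (+ n ℚᵘ./ 1))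
                                                   (toℚᵘ-fromℚᵘ (+ 1 ℚᵘ./ n)) ⟩
  + n ℚᵘ./ 1 ℚᵘ.* ℚᵘ.1/ (+ n ℚᵘ./ 1)  ≃⟨ ℚᵘ.*-inverseʳ (+ n ℚᵘ./ 1) ⟩
  ℚᵘ.1ℚᵘ                              ∎)
  where open ℚᵘ.≤-Reasoning

p≤p+q : ∀ p {q} → 0ℚ ≤ q → p ≤ p + q
p≤p+q p {q} 0≤q = begin
  p       ≡⟨ +-identityʳ p ⟨
  p + 0ℚ  ≤⟨ +-monoʳ-≤ p 0≤q ⟩
  p + q   ∎
  where open ≤-Reasoning

1≤n/1 : ∀ n .{{_ : NonZero n}} → 1ℚ ≤ + n / 1
1≤n/1 (suc k) = begin
  1ℚ               ≤⟨ p≤p+q 1ℚ (nonNegative⁻¹ (+ k / 1) {{normalize-nonNeg k 1}}) ⟩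
  1ℚ + + k / 1     ≡⟨ [m+n]/1≡m/1+n/1 1 k ⟨
  + suc k / 1      ∎
  where open ≤-Reasoning

[1+n]/1*t≡n/1*t+t : ∀ n t → + suc n / 1 * t ≡ + n / 1 * t + t
[1+n]/1*t≡n/1*t+t n t = begin
  + suc n / 1 * t             ≡⟨ cong (_* t) ([m+n]/1≡m/1+n/1 1 n) ⟩
  (1ℚ + + n / 1) * t          ≡⟨ *-distribʳ-+ t 1ℚ (+ n / 1) ⟩
  1ℚ * t + + n / 1 * t        ≡⟨ cong (_+ + n / 1 * t) (*-identityˡ t) ⟩
  t + + n / 1 * t             ≡⟨ +-comm t (+ n / 1 * t) ⟩
  + n / 1 * t + t             ∎
  where open ≡-Reasoning

weight≤size*t : ∀ {t} → 1ℚ ≤ t → ∀ T → Valid t T → weight T ≤ + size T / 1 * t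
weight≤size*t {t} 1≤t (leaf w) (_ , w≤1) = begin
  w          ≤⟨ w≤1 ⟩
  1ℚ         ≤⟨ 1≤t ⟩
  t          ≡⟨ *-identityˡ t ⟨
  1ℚ * t     ∎
  where open ≤-Reasoning
weight≤size*t {t} 1≤t (node1 w c) (_ , w≤c+t , valid-c) = begin
  w                            ≤⟨ w≤c+t ⟩
  weight c + t                 ≤⟨ +-monoˡ-≤ t (weight≤size*t 1≤t c valid-c) ⟩
  + size c / 1 * t + t         ≡⟨ [1+n]/1*t≡n/1*t+t (size c) t ⟨
  + suc (size c) / 1 * t       ∎
  where open ≤-Reasoning
weight≤size*t {t} 1≤t (node2 w c₁ c₂) (_ , w≤c₁+c₂ , valid-c₁ , valid-c₂) = begin
  w                                        ≤⟨ w≤c₁+c₂ ⟩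
  weight c₁ + weight c₂                    ≤⟨ +-mono-≤ (weight≤size*t 1≤t c₁ valid-c₁)
                                                      (weight≤size*t 1≤t c₂ valid-c₂) ⟩
  + n₁ / 1 * t + + n₂ / 1 * t              ≡⟨ *-distribʳ-+ t (+ n₁ / 1) (+ n₂ / 1) ⟨
  (+ n₁ / 1 + + n₂ / 1) * t                ≡⟨ cong (_* t) ([m+n]/1≡m/1+n/1 n₁ n₂) ⟨
  + (n₁ ℕ.+ n₂) / 1 * t                    ≤⟨ p≤p+q _ (≤-trans (nonNegative⁻¹ 1ℚ) 1≤t) ⟩
  + (n₁ ℕ.+ n₂) / 1 * t + t                ≡⟨ [1+n]/1*t≡n/1*t+t (n₁ ℕ.+ n₂) t ⟨
  + suc (n₁ ℕ.+ n₂) / 1 * t                ∎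
  where
  open ≤-Reasoning
  n₁ n₂ : ℕ
  n₁ = size c₁
  n₂ = size c₂

lemma2 : (t : ℕ) → .{{_ : NonZero t}} → (T : WTree) → Valid (+ t / 1) T →
           weight T * (+ 1 / t) ≤ + size T / 1
lemma2 t T valid = begin
  weight T * (+ 1 / t)                      ≤⟨ *-monoʳ-≤-nonNeg (+ 1 / t) {{normalize-nonNeg 1 t}}
                                                 (weight≤size*t (1≤n/1 t) T valid) ⟩
  + size T / 1 * (+ t / 1) * (+ 1 / t)      ≡⟨ *-assoc (+ size T / 1) (+ t / 1) (+ 1 / t) ⟩
  + size T / 1 * (+ t / 1 * (+ 1 / t))      ≡⟨ cong (+ size T / 1 *_) (n/1*1/n≡1 t) ⟩
  + size T / 1 * 1ℚ                         ≡⟨ *-identityʳ (+ size T / 1) ⟩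
  + size T / 1                              ∎
  where open ≤-Reasoning
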